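{- Let $d\geq 2$, $k\geq 1$, $r\geq 0$ be integers and let $G$ be a complete proper strict $(r,k,d)$-graph. Then there is a unique partition $\{A_i\}_{i=1}^t$ of the vertex set $\{1,\dots,k\}$ such that for all $a\in A_i$, $a'\in A_j$ with $a\neq a'$ we have $\xi_G(a,a')<r$ if $i=j$ and $\xi_G(a,a')=r$ if $i\neq j$. Moreover, $2\leq t\leq d$.
   Context: An $(r,k,d)$-graph is a graph $G$ with vertex set $\{1,\dots,k\}$ together with, for each edge $\overline{ab}$, values $\xi_G(a,b),\xi_G(b,a)\in\{ -1,\dots,r\}$ and $\eta_G(a,b),\eta_G(b,a)\in\{0,\dots,d-1\}$ such that $\xi_G(a,b)=\xi_G(b,a)$, $\eta_G(a,b)+\eta_G(b,a)\equiv 0\pmod d$, $\eta=0$ when $\xi=-1$, and $\eta\in\{1,\dots,d-1\}$ when $\xi\geq 0$. Strict: some edge $\overline{ab}$ has $\xi_G(a,b)=r$. Complete: every pair of distinct vertices is joined. Proper: for all distinct vertices $a,b,c$ with $\overline{ab},\overline{ac},\overline{bc}$ edges: (1) if $\xi_G(a,b)=\xi_G(b,c)=-1$ then $\xi_G(a,c)=-1$; (2) if $\xi_G(a,b)<\xi_G(b,c)$ then $\xi_G(a,c)=\xi_G(b,c)$ and $\eta_G(a,c)=\eta_G(b,c)$; (3) if $0\leq\xi_G(a,b)=\xi_G(b,c)$ and $\eta_G(a,b)+\eta_G(b,c)\neq d$ then $\xi_G(a,c)=\xi_G(a,b)$ and $\eta_G(a,c)\equiv\eta_G(a,b)+\eta_G(b,c)\pmod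 d$; (4) if $0\leq\xi_G(a,b)=\xi_G(b,c)$ and $\eta_G(a,b)+\eta_G(b,c)=d$ then $\xi_G(a,c)<\xi_G(a,b)$. -}

module Defs where

open import Data.Nat as ℕ using (ℕ; _+_; _*_)
open import Data.Integer as ℤ using (ℤ; +_; -[1+_])
open import Data.Fin using (Fin)
open import Data.Product using (Σ; ∃; ∃-syntax; _×_; _,_)
open import Relation.Binary.PropositionalEquality using (_≡_; _≢_)
open import Relation.Nullary using (¬_)
open import Data.Empty using (⊥)
open import Function.Bundles using (_⇔_)

ModEq : ℕ → ℕ → ℕ → Set
ModEq d x y = ∃[ p ] ∃[ q ] (x + p * d ≡ y + q * d)

-1ℤ : ℤ
-1ℤ = -[1+ 0 ]

-- An (r,k,d)-graph on vertex set Fin k (= {1,…,k}).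
-- ξ and η are total functions, but all constraints concern edges only;
-- their values on non-edges are irrelevant.
record Graph (r k d : ℕ) : Set₁ where
  field
    Edge       : Fin k → Fin k → Set
    edge-sym   : ∀ {a b} → Edge a b → Edge b a
    edge-irr   : ∀ {a} → Edge a a → ⊥
    ξ          : Fin k → Fin k → ℤ
    η          : Fin k → Fin k → ℕ
    ξ-lower    : ∀ {a b} → Edge a b → -1ℤ ℤ.≤ ξ a b
    ξ-upper    : ∀ {a b} → Edge a b → ξ a b ℤ.≤ + r
    η-upper    : ∀ {a b} → Edge a b → η a b ℕ.< d
    ξ-sym      : ∀ {a b} → Edge a b → ξ a b ≡ ξ b a
    η-sum      : ∀ {a b} → Edge a b → ModEq d (η a b + η b a) 0
    η-neg      : ∀ {a b} → Edge a b → ξ a b ≡ -1ℤ → η a b ≡ 0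
    η-pos      : ∀ {a b} → Edge a b → + 0 ℤ.≤ ξ a b → 1 ℕ.≤ η a b

module _ {r k d : ℕ} (G : Graph r k d) where
  open Graph G

  Strict : Set
  Strict = ∃[ a ] ∃[ b ] (Edge a b × ξ a b ≡ + r)

  Complete : Set
  Complete = ∀ a b → a ≢ b → Edge a b

  Proper : Set
  Proper = ∀ a b c → a ≢ b → a ≢ c → b ≢ c →
           Edge a b → Edge a c → Edge b c →
             ((ξ a b ≡ -1ℤ → ξ b c ≡ -1ℤ → ξ a c ≡ -1ℤ)
           × (ξ a b ℤ.< ξ b c → ξ a c ≡ ξ b c × η a c ≡ η b c)
           × (+ 0 ℤ.≤ ξ a b → ξ a b ≡ ξ b c → η a b + η b c ≢ d →
                ξ a c ≡ ξ a b × ModEq d (η a c) (η a b + η b c))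
           × (+ 0 ℤ.≤ ξ a b → ξ a b ≡ ξ b c → η a b + η b c ≡ d →
                ξ a c ℤ.< ξ a b))

-- A partition of Fin k into t nonempty blocks A_1,…,A_t, encoded by the
-- surjective block-index map.
record Partition (k : ℕ) : Set where
  field
    t        : ℕ
    block    : Fin k → Fin t
    nonempty : ∀ (i : Fin t) → ∃[ a ] (block a ≡ i)

open Partition public

-- Two partitions are the same partition (up to relabelling of blocks).
SamePartition : ∀ {k} → Partition k → Partition k → Set
SamePartition P Q = ∀ a a' → (block P a ≡ block P a') ⇔ (block Q a ≡ block Q a')

Separates : ∀ {r k d} → Graph r k d → Partition k → Set
Separates {r} G P = ∀ a a' → a ≢ a' →
    (block P a ≡ block P a' → Graph.ξ G a a' ℤ.< + r)
  × (block P a ≢ block P a' → Graph.ξ G a a' ≡ + r)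

-- Say a ∼ b when a = b or ξ(a,b) < r. Properness makes ξ an ultrametric,
-- ξ(a,c) ≤ max (ξ(a,b), ξ(b,c)), so ∼ is an equivalence relation; its classes
-- form the partition, and the separating property pins down block-equality as ∼,
-- which gives uniqueness. A strict edge joins two classes, so t ≥ 2. For t ≤ d,
-- fix a vertex a₀ and label every vertex b outside its class by η(a₀,b) ∈ [1,d),
-- and the class of a₀ by 0: if η(a₀,b) = η(a₀,b') then η(b,a₀) + η(a₀,b') = d
-- with both ξ-values equal to r, so rule (4) forces ξ(b,b') < r, i.e. b ∼ b'.
module Submission where

open import Defs
open import Data.Nat using (ℕ; _≤_)
open import Data.Product using (∃-syntax; _×_)

open import Level using (0ℓ)
open import Data.Nat as ℕ using (zero; suc; z≤n; s≤s; _+_; _*_)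
import Data.Nat.Properties as ℕ
open import Data.Integer as ℤ using (+_; -[1+_]; +≤+; -≤-; _⊔_)
import Data.Integer.Properties as ℤ
open import Data.Fin using (Fin; toℕ; fromℕ<)
open import Data.Fin.Properties using (_≟_; any?; suc-injective; injective⇒≤; toℕ-fromℕ<)
open import Data.Product using (Σ-syntax; _,_; proj₁; proj₂)
open import Data.Sum using (_⊎_; inj₁; inj₂)
open import Data.Empty using (⊥-elim)
open import Function using (_∘_)
open import Function.Bundles using (_⇔_; mk⇔; Equivalence)
import Function.Properties.Equivalence as ⇔
open import Relation.Nullary using (¬_; Dec; yes; no)
open import Relation.Nullary.Decidable using (_⊎-dec_)
open import Relation.Binary using (Rel; Decidable; IsDecEquivalence; tri<; tri≈; tri>)
import Relation.Binary.Construct.On as On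
open import Relation.Binary.PropositionalEquality
open ≡-Reasoning

open Equivalence using (to; from)

partitionOf : ∀ {k} {_∼_ : Rel (Fin k) 0ℓ} → IsDecEquivalence _∼_ →
              Σ[ P ∈ Partition k ] (∀ a b → block P a ≡ block P b ⇔ a ∼ b)
partitionOf {zero} _ = record { t = 0 ; block = λ () ; nonempty = λ () } , λ ()
partitionOf {suc k} isDecEq
  with partitionOf (On.isDecEquivalence Fin.suc isDecEq)
     | any? (λ a → IsDecEquivalence._≟_ isDecEq Fin.zero (Fin.suc a))
... | P , P-∼ | yes (a₀ , 0∼a₀) = P⁺ , P⁺-∼
  where
  open IsDecEquivalence isDecEq renaming (refl to ∼-refl; sym to ∼-sym; trans to ∼-trans)
  blk : Fin (suc k) → Fin (t P)
  blk Fin.zero    = block P a₀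
  blk (Fin.suc a) = block P a
  P⁺ : Partition (suc k)
  P⁺ = record { t = t P ; block = blk
              ; nonempty = λ i → Fin.suc (proj₁ (nonempty P i)) , proj₂ (nonempty P i) }
  P⁺-∼ : ∀ a b → blk a ≡ blk b ⇔ _
  P⁺-∼ Fin.zero    Fin.zero    = mk⇔ (λ _ → ∼-refl) (λ _ → refl)
  P⁺-∼ Fin.zero    (Fin.suc b) = mk⇔ (∼-trans 0∼a₀ ∘ to (P-∼ a₀ b))
                                     (from (P-∼ a₀ b) ∘ ∼-trans (∼-sym 0∼a₀))
  P⁺-∼ (Fin.suc a) Fin.zero    = mk⇔ (λ e → ∼-trans (to (P-∼ a a₀) e) (∼-sym 0∼a₀))
                                     (λ a∼0 → from (P-∼ a a₀) (∼-trans a∼0 0∼a₀))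
  P⁺-∼ (Fin.suc a) (Fin.suc b) = P-∼ a b
... | P , P-∼ | no 0≁suc = P⁺ , P⁺-∼
  where
  open IsDecEquivalence isDecEq renaming (refl to ∼-refl; sym to ∼-sym)
  blk : Fin (suc k) → Fin (suc (t P))
  blk Fin.zero    = Fin.zero
  blk (Fin.suc a) = Fin.suc (block P a)
  blk-onto : ∀ i → ∃[ a ] (blk a ≡ i)
  blk-onto Fin.zero    = Fin.zero , refl
  blk-onto (Fin.suc i) = Fin.suc (proj₁ (nonempty P i)) , cong Fin.suc (proj₂ (nonempty P i))
  P⁺ : Partition (suc k)
  P⁺ = record { t = suc (t P) ; block = blk ; nonempty = blk-onto }
  P⁺-∼ : ∀ a b → blk a ≡ blk b ⇔ _
  P⁺-∼ Fin.zero    Fin.zero    = mk⇔ (λ _ → ∼-refl) (λ _ → refl)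
  P⁺-∼ Fin.zero    (Fin.suc b) = mk⇔ (λ ()) (λ 0∼b → ⊥-elim (0≁suc (b , 0∼b)))
  P⁺-∼ (Fin.suc a) Fin.zero    = mk⇔ (λ ()) (λ a∼0 → ⊥-elim (0≁suc (a , ∼-sym a∼0)))
  P⁺-∼ (Fin.suc a) (Fin.suc b) = ⇔.trans (mk⇔ suc-injective (cong Fin.suc)) (P-∼ a b)

i≢j⇒2≤n : ∀ {n} {i j : Fin n} → i ≢ j → 2 ≤ n
i≢j⇒2≤n {suc zero}    {Fin.zero} {Fin.zero} i≢j = ⊥-elim (i≢j refl)
i≢j⇒2≤n {suc (suc _)} _ = s≤s (s≤s z≤n)

distinguishing⇒t≤ : ∀ {k d} (P : Partition k) (f : Fin k → Fin d) →
                    (∀ a b → f a ≡ f b → block P a ≡ block P b) → t P ≤ d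
distinguishing⇒t≤ P f f≡⇒block≡ = injective⇒≤ {f = f ∘ rep} λ {i} {j} f-rep≡ → begin
  i                 ≡⟨ sym (block-rep i) ⟩
  block P (rep i)   ≡⟨ f≡⇒block≡ (rep i) (rep j) f-rep≡ ⟩
  block P (rep j)   ≡⟨ block-rep j ⟩
  j                 ∎
  where
  rep : Fin (t P) → Fin _
  rep i = proj₁ (nonempty P i)
  block-rep : ∀ i → block P (rep i) ≡ i
  block-rep i = proj₂ (nonempty P i)

ModEq-0⇒≡d : ∀ {d s} → ModEq d s 0 → 0 ℕ.< s → s ℕ.< d + d → s ≡ d
ModEq-0⇒≡d {d} {s} (p , q , s+pd≡qd) = go p q s+pd≡qd
  where
  go : ∀ p q → s + p * d ≡ q * d → 0 ℕ.< s → s ℕ.< d + d → s ≡ d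
  go zero zero eq 0<s _ = ⊥-elim (ℕ.<⇒≢ 0<s (sym (trans (sym (ℕ.+-identityʳ s)) eq)))
  go zero (suc zero) eq _ _ = trans (sym (ℕ.+-identityʳ s)) (trans eq (ℕ.+-identityʳ d))
  go zero (suc (suc q)) eq _ s<2d = ⊥-elim (ℕ.<⇒≱ s<2d (ℕ.≤-trans
    (ℕ.+-monoʳ-≤ d (ℕ.m≤m+n d (q * d)))
    (ℕ.≤-reflexive (sym (trans (sym (ℕ.+-identityʳ s)) eq)))))
  go (suc p) zero eq 0<s _ = ⊥-elim (ℕ.<⇒≢ 0<s (sym (ℕ.m+n≡0⇒m≡0 s eq)))
  go (suc p) (suc q) eq = go p q (ℕ.+-cancelˡ-≡ d _ _ (begin
      d + (s + p * d)   ≡⟨ ℕ.+-comm d _ ⟩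
      s + p * d + d     ≡⟨ ℕ.+-assoc s _ d ⟩
      s + (p * d + d)   ≡⟨ cong (_+_ s) (ℕ.+-comm (p * d) d) ⟩
      s + (d + p * d)   ≡⟨ eq ⟩
      d + q * d         ∎))

-1≤i∧0≰i⇒i≡-1 : ∀ {i} → -1ℤ ℤ.≤ i → ¬ (+ 0 ℤ.≤ i) → i ≡ -1ℤ
-1≤i∧0≰i⇒i≡-1 {+ _}           _        0≰i = ⊥-elim (0≰i (+≤+ z≤n))
-1≤i∧0≰i⇒i≡-1 { -[1+ zero ]}  _        _   = refl
-1≤i∧0≰i⇒i≡-1 { -[1+ suc _ ]} (-≤- ()) _

⊔-<-lub : ∀ {i j k} → i ℤ.< k → j ℤ.< k → i ⊔ j ℤ.< k
⊔-<-lub {i} {j} i<k j<k with ℤ.⊔-sel i j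
... | inj₁ i⊔j≡i = subst (ℤ._< _) (sym i⊔j≡i) i<k
... | inj₂ i⊔j≡j = subst (ℤ._< _) (sym i⊔j≡j) j<k

module CompleteProperGraph {r k d} (G : Graph r k d)
                           (complete : Complete G) (proper : Proper G) where
  open Graph G

  0≤r : + 0 ℤ.≤ + r
  0≤r = +≤+ z≤n

  ξ-sym′ : ∀ {a b} → a ≢ b → ξ a b ≡ ξ b a
  ξ-sym′ {a} {b} a≢b = ξ-sym (complete a b a≢b)

  η-sum≡d : ∀ {a b} → Edge a b → + 0 ℤ.≤ ξ a b → η a b + η b a ≡ d
  η-sum≡d {a} {b} ab 0≤ξ = ModEq-0⇒≡d (η-sum ab)
    (ℕ.+-mono-≤ (η-pos ab 0≤ξ) z≤n)
    (ℕ.+-mono-< (η-upper ab) (η-upper ba))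
    where
    ba : Edge b a
    ba = edge-sym ab

  ξ-≤-of-equal-levels : ∀ {a b c} → a ≢ b → a ≢ c → b ≢ c →
                        ξ a b ≡ ξ b c → ξ a c ℤ.≤ ξ a b
  ξ-≤-of-equal-levels {a} {b} {c} a≢b a≢c b≢c ξ≡
    with proper a b c a≢b a≢c b≢c (complete a b a≢b) (complete a c a≢c) (complete b c b≢c)
       | + 0 ℤ.≤? ξ a b
  ... | rule₁ , _ , _ , _ | no 0≰ξ =
    let ξab≡-1 = -1≤i∧0≰i⇒i≡-1 (ξ-lower (complete a b a≢b)) 0≰ξ
    in ℤ.≤-reflexive (trans (rule₁ ξab≡-1 (trans (sym ξ≡) ξab≡-1)) (sym ξab≡-1))
  ... | _ , _ , rule₃ , rule₄ | yes 0≤ξ with η a b + η b c ℕ.≟ d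
  ...   | yes η-sum≡d = ℤ.<⇒≤ (rule₄ 0≤ξ ξ≡ η-sum≡d)
  ...   | no  η-sum≢d = ℤ.≤-reflexive (proj₁ (rule₃ 0≤ξ ξ≡ η-sum≢d))

  ξ-ultrametric : ∀ {a b c} → a ≢ b → a ≢ c → b ≢ c → ξ a c ℤ.≤ ξ a b ⊔ ξ b c
  ξ-ultrametric {a} {b} {c} a≢b a≢c b≢c with ℤ.<-cmp (ξ a b) (ξ b c)
  ... | tri< ξab<ξbc _ _ = ℤ.≤-trans (ℤ.≤-reflexive (proj₁ (rule₂ ξab<ξbc))) (ℤ.i≤j⊔i _ _)
    where
    rule₂ = proj₁ (proj₂ (proper a b c a≢b a≢c b≢c
                     (complete a b a≢b) (complete a c a≢c) (complete b c b≢c)))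
  ... | tri> _ _ ξbc<ξab = ℤ.≤-trans (ℤ.≤-reflexive ξac≡ξab) (ℤ.i≤i⊔j _ _)
    where
    c≢b = ≢-sym b≢c
    c≢a = ≢-sym a≢c
    b≢a = ≢-sym a≢b
    rule₂ = proj₁ (proj₂ (proper c b a c≢b c≢a b≢a
                     (complete c b c≢b) (complete c a c≢a) (complete b a b≢a)))
    ξac≡ξab : ξ a c ≡ ξ a b
    ξac≡ξab = begin
      ξ a c  ≡⟨ ξ-sym′ a≢c ⟩
      ξ c a  ≡⟨ proj₁ (rule₂ (subst₂ ℤ._<_ (ξ-sym′ b≢c) (ξ-sym′ a≢b) ξbc<ξab)) ⟩
      ξ b a  ≡⟨ ξ-sym′ b≢a ⟩
      ξ a b  ∎
  ... | tri≈ _ ξab≡ξbc _ =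
    ℤ.≤-trans (ξ-≤-of-equal-levels a≢b a≢c b≢c ξab≡ξbc) (ℤ.i≤i⊔j _ _)

  infix 4 _∼_ _∼?_
  _∼_ : Rel (Fin k) 0ℓ
  a ∼ b = a ≡ b ⊎ ξ a b ℤ.< + r

  _∼?_ : Decidable _∼_
  a ∼? b = (a ≟ b) ⊎-dec (ξ a b ℤ.<? + r)

  ∼-sym : ∀ {a b} → a ∼ b → b ∼ a
  ∼-sym (inj₁ a≡b) = inj₁ (sym a≡b)
  ∼-sym {a} {b} (inj₂ ξ<r) with a ≟ b
  ... | yes a≡b = inj₁ (sym a≡b)
  ... | no  a≢b = inj₂ (subst (ℤ._< + r) (ξ-sym′ a≢b) ξ<r)

  ∼-trans : ∀ {a b c} → a ∼ b → b ∼ c → a ∼ c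
  ∼-trans (inj₁ refl) b∼c = b∼c
  ∼-trans a∼b (inj₁ refl) = a∼b
  ∼-trans {a} {b} {c} (inj₂ ξab<r) (inj₂ ξbc<r) with a ≟ c | a ≟ b | b ≟ c
  ... | yes a≡c | _        | _        = inj₁ a≡c
  ... | no  _   | yes refl | _        = inj₂ ξbc<r
  ... | no  _   | no  _    | yes refl = inj₂ ξab<r
  ... | no  a≢c | no  a≢b  | no  b≢c  =
    inj₂ (ℤ.≤-<-trans (ξ-ultrametric a≢b a≢c b≢c) (⊔-<-lub ξab<r ξbc<r))

  ∼-isDecEquivalence : IsDecEquivalence _∼_
  ∼-isDecEquivalence = record
    { isEquivalence = record { refl = inj₁ refl ; sym = ∼-sym ; trans = ∼-trans }
    ; _≟_ = _∼?_
    }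

  ≁⇒≢ : ∀ {a b} → ¬ a ∼ b → a ≢ b
  ≁⇒≢ a≁b = a≁b ∘ inj₁

  ≁⇒ξ≡r : ∀ {a b} → ¬ a ∼ b → ξ a b ≡ + r
  ≁⇒ξ≡r {a} {b} a≁b =
    ℤ.≤-antisym (ξ-upper (complete a b (≁⇒≢ a≁b))) (ℤ.≮⇒≥ (a≁b ∘ inj₂))

  ξ≡r⇒≁ : ∀ {a b} → Edge a b → ξ a b ≡ + r → ¬ a ∼ b
  ξ≡r⇒≁ ab _   (inj₁ refl) = edge-irr ab
  ξ≡r⇒≁ _  ξ≡r (inj₂ ξ<r)  = ℤ.<⇒≢ ξ<r ξ≡r

  ≁⇒1≤η : ∀ {a b} → ¬ a ∼ b → 1 ≤ η a b
  ≁⇒1≤η {a} {b} a≁b =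
    η-pos (complete a b (≁⇒≢ a≁b)) (subst (+ 0 ℤ.≤_) (sym (≁⇒ξ≡r a≁b)) 0≤r)

  separates⇔block≡⇔∼ : ∀ Q → Separates G Q ⇔ (∀ a b → block Q a ≡ block Q b ⇔ a ∼ b)
  separates⇔block≡⇔∼ Q = mk⇔ block≡⇔∼ separates
    where
    block≡⇔∼ : Separates G Q → ∀ a b → block Q a ≡ block Q b ⇔ a ∼ b
    block≡⇔∼ sep a b = mk⇔ block≡⇒∼ ∼⇒block≡
      where
      block≡⇒∼ : block Q a ≡ block Q b → a ∼ b
      block≡⇒∼ Qa≡Qb with a ≟ b
      ... | yes a≡b = inj₁ a≡b
      ... | no  a≢b = inj₂ (proj₁ (sep a b a≢b) Qa≡Qb)
      ∼⇒block≡ : a ∼ b → block Q a ≡ block Q b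
      ∼⇒block≡ (inj₁ refl) = refl
      ∼⇒block≡ (inj₂ ξ<r) with block Q a ≟ block Q b | a ≟ b
      ... | yes Qa≡Qb | _        = Qa≡Qb
      ... | no  _     | yes refl = refl
      ... | no  Qa≢Qb | no  a≢b  = ⊥-elim (ℤ.<⇒≢ ξ<r (proj₂ (sep a b a≢b) Qa≢Qb))
    separates : (∀ a b → block Q a ≡ block Q b ⇔ a ∼ b) → Separates G Q
    separates Q-∼ a b a≢b = ξ<r ∘ to (Q-∼ a b) , λ Qa≢Qb → ≁⇒ξ≡r (Qa≢Qb ∘ from (Q-∼ a b))
      where
      ξ<r : a ∼ b → ξ a b ℤ.< + r
      ξ<r (inj₁ a≡b) = ⊥-elim (a≢b a≡b)
      ξ<r (inj₂ ξ<r) = ξ<r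

  classes : Partition k
  classes = proj₁ (partitionOf ∼-isDecEquivalence)

  classes-∼ : ∀ a b → block classes a ≡ block classes b ⇔ a ∼ b
  classes-∼ = proj₂ (partitionOf ∼-isDecEquivalence)

  η≡⇒∼ : ∀ {a b b′} → ¬ a ∼ b → ¬ a ∼ b′ → η a b ≡ η a b′ → b ∼ b′
  η≡⇒∼ {a} {b} {b′} a≁b a≁b′ η≡ with b ≟ b′
  ... | yes b≡b′ = inj₁ b≡b′
  ... | no  b≢b′ = inj₂ (subst (ξ b b′ ℤ.<_) ξba≡r
                           (rule₄ 0≤ξba (trans ξba≡r (sym (≁⇒ξ≡r a≁b′))) ηba+ηab′≡d))
    where
    b≢a = ≢-sym (≁⇒≢ a≁b)
    ξba≡r : ξ b a ≡ + r
    ξba≡r = trans (ξ-sym′ b≢a) (≁⇒ξ≡r a≁b)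
    0≤ξba : + 0 ℤ.≤ ξ b a
    0≤ξba = subst (+ 0 ℤ.≤_) (sym ξba≡r) 0≤r
    ηba+ηab′≡d : η b a + η a b′ ≡ d
    ηba+ηab′≡d = begin
      η b a + η a b′  ≡⟨ cong (_+_ (η b a)) (sym η≡) ⟩
      η b a + η a b   ≡⟨ η-sum≡d (complete b a b≢a) 0≤ξba ⟩
      d               ∎
    rule₄ = proj₂ (proj₂ (proj₂ (proper b a b′ b≢a b≢b′ (≁⇒≢ a≁b′)
              (complete b a b≢a) (complete b b′ b≢b′) (complete a b′ (≁⇒≢ a≁b′)))))

  module Labelling (a₀ : Fin k) (0<d : 0 ℕ.< d) where

    label : Fin k → Fin d
    label b with a₀ ∼? b
    ... | yes _    = fromℕ< 0<d
    ... | no  a₀≁b = fromℕ< (η-upper (complete a₀ b (≁⇒≢ a₀≁b)))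

    toℕ-label-∼ : ∀ {b} → a₀ ∼ b → toℕ (label b) ≡ 0
    toℕ-label-∼ {b} a₀∼b with a₀ ∼? b
    ... | yes _    = toℕ-fromℕ< 0<d
    ... | no  a₀≁b = ⊥-elim (a₀≁b a₀∼b)

    toℕ-label-≁ : ∀ {b} → ¬ a₀ ∼ b → toℕ (label b) ≡ η a₀ b
    toℕ-label-≁ {b} a₀≁b with a₀ ∼? b
    ... | yes a₀∼b = ⊥-elim (a₀≁b a₀∼b)
    ... | no  _    = toℕ-fromℕ< _

    label≡⇒∼ : ∀ b b′ → label b ≡ label b′ → b ∼ b′
    label≡⇒∼ b b′ ℓ≡ = by-class (a₀ ∼? b) (a₀ ∼? b′) (cong toℕ ℓ≡)
      where
      by-class : Dec (a₀ ∼ b) → Dec (a₀ ∼ b′) → toℕ (label b) ≡ toℕ (label b′) → b ∼ b′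
      by-class (yes a₀∼b) (yes a₀∼b′) _ = ∼-trans (∼-sym a₀∼b) a₀∼b′
      by-class (yes a₀∼b) (no  a₀≁b′) ℓ≡ = ⊥-elim (ℕ.<⇒≢ (≁⇒1≤η a₀≁b′) (begin
        0                ≡⟨ sym (toℕ-label-∼ a₀∼b) ⟩
        toℕ (label b)    ≡⟨ ℓ≡ ⟩
        toℕ (label b′)   ≡⟨ toℕ-label-≁ a₀≁b′ ⟩
        η a₀ b′          ∎))
      by-class (no  a₀≁b) (yes a₀∼b′) ℓ≡ = ⊥-elim (ℕ.<⇒≢ (≁⇒1≤η a₀≁b) (begin
        0                ≡⟨ sym (toℕ-label-∼ a₀∼b′) ⟩
        toℕ (label b′)   ≡⟨ sym ℓ≡ ⟩
        toℕ (label b)    ≡⟨ toℕ-label-≁ a₀≁b ⟩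
        η a₀ b           ∎))
      by-class (no  a₀≁b) (no  a₀≁b′) ℓ≡ = η≡⇒∼ a₀≁b a₀≁b′ (begin
        η a₀ b           ≡⟨ sym (toℕ-label-≁ a₀≁b) ⟩
        toℕ (label b)    ≡⟨ ℓ≡ ⟩
        toℕ (label b′)   ≡⟨ toℕ-label-≁ a₀≁b′ ⟩
        η a₀ b′          ∎)

lemma2p8 : {r k d : ℕ} → 2 ≤ d → 1 ≤ k → (G : Graph r k d) →
    Complete G → Proper G → Strict G →
    ∃[ P ] (Separates G P × (∀ Q → Separates G Q → SamePartition P Q)
    × 2 ≤ t P × t P ≤ d)
lemma2p8 {d = d} 2≤d _ G complete proper (a₀ , b₀ , a₀b₀ , ξ≡r) =
  classes , from (separates⇔block≡⇔∼ classes) classes-∼ , unique , 2≤t , t≤d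
  where
  open CompleteProperGraph G complete proper
  open Labelling a₀ (ℕ.≤-trans (s≤s z≤n) 2≤d)
  unique : ∀ Q → Separates G Q → SamePartition classes Q
  unique Q sep a b = ⇔.trans (classes-∼ a b) (⇔.sym (to (separates⇔block≡⇔∼ Q) sep a b))
  2≤t : 2 ≤ t classes
  2≤t = i≢j⇒2≤n (ξ≡r⇒≁ a₀b₀ ξ≡r ∘ to (classes-∼ a₀ b₀))
  t≤d : t classes ≤ d
  t≤d = distinguishing⇒t≤ classes label λ b b′ → from (classes-∼ b b′) ∘ label≡⇒∼ b b′
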